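{- Let $J,J'\subseteq\{0,\dots,f-1\}$ and let $d=(d_0,\dots,d_{f-1})$, $d'=(d'_0,\dots,d'_{f-1})$ be $f$-tuples of integers with $0\le d_i\le e'-1$ if $i\in J$, $1\le d_i\le e'$ if $i\notin J$, $0\le d'_i\le e'-1$ if $i\in J'$, $1\le d'_i\le e'$ if $i\notin J'$. If $\mu(J,d)\cong\mu(J',d')$, then $J=J'$ and $d=d'$.
   Context: $p$ odd; $L/\mathbb Q_p$ finite with absolute ramification index $e'$ and residue field $k$ of degree $f$; $k_E$ a finite field containing images of embeddings of $k$; $\sigma_0:k\hookrightarrow k_E$, $\sigma_{i+1}^p=\sigma_i$ (indices mod $f$); $\omega_i$ the fundamental characters of $I_L$. $\overline\rho\cong\begin{pmatrix}\chi_2&*\\0&\chi_1\end{pmatrix}:G_L\to\mathrm{GL}_2(k_E)$ is generic: $\chi_1^{ -1}\chi_2|_{I_L}=\prod_i\omega_i^{b_i+e'}$ with integers $0\le b_i\le p-1-2e'$; fix integers $c_i$ with $\chi_1|_{I_L}=\prod_i\omega_i^{c_i}$. Serre weights $\mu_{m,n}=\bigotimes_i(\det^{m_i}\otimes\mathrm{Sym}^{n_i}k^2)\otimes_{k,\sigma_i}k_E$, with $\mu_{m,n}\cong\mu_{m',n'}$ iff $n=n'$ and $\sum m_ip^{f-i}\equiv\sum m'_ip^{f-i}\pmod{p^f-1}$. For $(J,d)$ as in the claim, $\mu(J,d)=\mu_{m,n}$ where: $m_i=c_i+p-1-d_i,n_i=b_i+2d_i$ if $i,i+1\in J$; $m_i=c_i+p-1-d_i,n_i=b_i+2d_i+1$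 if $i\in J,i+1\notin J$; $m_i=c_i+b_i+d_i-1,n_i=p-b_i-2d_i$ if $i\notin J,i+1\in J$; $m_i=c_i+b_i+d_i,n_i=p-1-b_i-2d_i$ if $i,i+1\notin J$ (indices mod $f$). -}

module Defs where

open import Data.Nat using (ℕ; zero; suc; NonZero)
open import Data.Nat.DivMod using (_mod_)
open import Data.Integer using (ℤ; +_; _+_; _-_; _*_; _^_; 0ℤ; 1ℤ)
open import Data.Integer.Divisibility using (_∣_)
open import Data.Fin using (Fin; toℕ)
open import Data.Fin.Subset using (Subset)
open import Data.Vec using (lookup)
open import Data.Bool using (Bool; true; false)
open import Data.Product using (_×_)
open import Relation.Binary.PropositionalEquality using (_≡_)

next : {f : ℕ} .{{_ : NonZero f}} → Fin f → Fin f
next {f} i = suc (toℕ i) mod f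

sumFin : {f : ℕ} → (Fin f → ℤ) → ℤ
sumFin {zero} g = 0ℤ
sumFin {suc f} g = g Fin.zero + sumFin (λ i → g (Fin.suc i))
  where import Data.Fin as Fin

-- The pair (m , n) of the Serre weight μ(J,d) = μ_{m,n}.
-- Arguments: p, b = (b_i), c = (c_i), J, d.
mμ : (p : ℕ) {f : ℕ} .{{_ : NonZero f}} → (b c : Fin f → ℤ) → Subset f → (Fin f → ℤ) → Fin f → ℤ
mμ p b c J d i with lookup J i | lookup J (next i)
... | true  | true  = c i + (+ p) - 1ℤ - d i
... | true  | false = c i + (+ p) - 1ℤ - d i
... | false | true  = c i + b i + d i - 1ℤ
... | false | false = c i + b i + d i

nμ : (p : ℕ) {f : ℕ} .{{_ : NonZero f}} → (b : Fin f → ℤ) → Subset f → (Fin f → ℤ) → Fin f → ℤ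
nμ p b J d i with lookup J i | lookup J (next i)
... | true  | true  = b i + (+ 2) * d i
... | true  | false = b i + (+ 2) * d i + 1ℤ
... | false | true  = (+ p) - b i - (+ 2) * d i
... | false | false = (+ p) - 1ℤ - b i - (+ 2) * d i

SerreIso : (p f : ℕ) → (m n m' n' : Fin f → ℤ) → Set
SerreIso p f m n m' n' =
  (∀ i → n i ≡ n' i) ×
  (((+ p) ^ f) - 1ℤ) ∣ (sumFin (λ i → m i * (+ p) ^ (f ∸ toℕ i)) - sumFin (λ i → m' i * (+ p) ^ (f ∸ toℕ i)))
  where open import Data.Nat using (_∸_)

μIso : (p : ℕ) {f : ℕ} .{{_ : NonZero f}} → (b c : Fin f → ℤ) → Subset f → (Fin f → ℤ) → Subset f → (Fin f → ℤ) → Set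
μIso p {f} b c J d J' d' = SerreIso p f (mμ p b c J d) (nμ p b J d) (mμ p b c J' d') (nμ p b J' d')

Admissible : (e' : ℕ) {f : ℕ} → Subset f → (Fin f → ℤ) → Set
Admissible e' J d = ∀ i → (i ∈ J → (0ℤ ≤ d i × d i ≤ (+ e') - 1ℤ)) × (i ∉ J → (1ℤ ≤ d i × d i ≤ + e'))
  where open import Data.Fin.Subset using (_∈_; _∉_)
        open import Data.Integer using (_≤_)

-- At every index i, 2 m_i + n_i = 2 c_i + b_i - 1 + p + p·[i ∈ J] - [i+1 ∈ J], so if
-- n = n' then 2 (m_i - m'_i) = p w_i - w_{i+1} with w_i = [i ∈ J] - [i ∈ J'] ∈ {-1, 0, 1}.
-- Weighting by p^(f-i) and summing, the right-hand side telescopes cyclically to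
-- p w_0 (p^f - 1).  Since p^f - 1 divides the weighted difference of the m's and p is odd,
-- this forces w_0 = 0.  When w_i = 0, w_{i+1} is even, hence 0, so w vanishes along
-- i ↦ i+1 and J = J'.  Finally, with J = J' the entry n_i is injective in d_i.
module Submission where

open import Defs
open import Data.Bool using (Bool; true; false)
import Data.Bool.Properties as Bool
open import Data.Empty using (⊥-elim)
open import Data.Fin using (Fin; zero; suc; toℕ)
open import Data.Fin.Properties using (toℕ-injective; toℕ-fromℕ<; toℕ<n)
open import Data.Fin.Subset using (Subset)
open import Data.Integer
  using (ℤ; +_; _+_; _-_; _*_; _^_; -_; 0ℤ; 1ℤ; -1ℤ; ∣_∣; _≤_; ≢-nonZero)
open import Data.Integer.Divisibility using (_∣_; *-monoʳ-∣; *-cancelʳ-∣)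
open import Data.Integer.Properties
  using (+-0-abelianGroup; +-inverseʳ; +-minus-telescope; *-zeroʳ; *-cancelˡ-≡;
         neg-injective; abs-*; pos-*; i-j≡0⇒i≡j; +-injective)
open import Data.Integer.Tactic.RingSolver using (solve; solve-∀)
open import Data.List using (_∷_; [])
open import Data.Nat as ℕ using (ℕ; NonZero; _≥_; _%_; _/_; _∸_)
open import Data.Nat.DivMod using (_mod_; m<n⇒m%n≡m; m≡m%n+[m/n]*n; [m+kn]%n≡m%n; n%n≡0)
open import Data.Nat.Divisibility using (n∣m⇒m%n≡0) renaming (_∣_ to _∣ℕ_)
open import Data.Nat.Primality using (Prime; prime⇒nonTrivial)
import Data.Nat.Properties as ℕ
open import Data.Product using (_×_; _,_)
open import Data.Vec using (lookup)
open import Data.Vec.Properties using (tabulate∘lookup; tabulate-cong)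
open import Function using (_∋_)
open import Algebra.Bundles using (AbelianGroup)
open import Algebra.Properties.Group (AbelianGroup.group +-0-abelianGroup)
  using () renaming (∙-cancelˡ to +-cancelˡ; ∙-cancelʳ to +-cancelʳ)
open import Relation.Nullary using (¬_)
open import Relation.Nullary.Decidable using (decidable-stable)
open import Relation.Binary.PropositionalEquality
open ≡-Reasoning

⟦_⟧ : Bool → ℤ
⟦ true ⟧ = 1ℤ
⟦ false ⟧ = 0ℤ

odd≢even : ∀ i j → 1ℤ + + 2 * i ≢ + 2 * j
odd≢even i j eq = ℕ.even≢odd ∣ j - i ∣ 0 (sym (trans (cong ∣_∣ 1≡2[j-i]) (abs-* (+ 2) (j - i))))
  where
  1≡2[j-i] : 1ℤ ≡ + 2 * (j - i)
  1≡2[j-i] = begin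
    1ℤ                       ≡⟨ solve (i ∷ []) ⟩
    (1ℤ + + 2 * i) - + 2 * i ≡⟨ cong (_- + 2 * i) eq ⟩
    + 2 * j - + 2 * i        ≡⟨ solve (i ∷ j ∷ []) ⟩
    + 2 * (j - i)            ∎

⟦⟧-even-difference : ∀ x x' k → ⟦ x ⟧ - ⟦ x' ⟧ ≡ + 2 * k → x ≡ x'
⟦⟧-even-difference true  true  k e = refl
⟦⟧-even-difference true  false k e = ⊥-elim (odd≢even 0ℤ k e)
⟦⟧-even-difference false true  k e = ⊥-elim (odd≢even -1ℤ k e)
⟦⟧-even-difference false false k e = refl

∣⟦⟧-⟦⟧∣≡1 : ∀ {x x'} → x ≢ x' → ∣ ⟦ x ⟧ - ⟦ x' ⟧ ∣ ≡ 1
∣⟦⟧-⟦⟧∣≡1 {true}  {true}  x≢x' = ⊥-elim (x≢x' refl)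
∣⟦⟧-⟦⟧∣≡1 {true}  {false} x≢x' = refl
∣⟦⟧-⟦⟧∣≡1 {false} {true}  x≢x' = refl
∣⟦⟧-⟦⟧∣≡1 {false} {false} x≢x' = ⊥-elim (x≢x' refl)

-- The entries of μ(J,d) at i, restated over scalars so that the ring solver can be used.
mAt : ℤ → Bool → Bool → ℤ → ℤ → ℤ → ℤ
mAt P true  true  b c d = c + P - 1ℤ - d
mAt P true  false b c d = c + P - 1ℤ - d
mAt P false true  b c d = c + b + d - 1ℤ
mAt P false false b c d = c + b + d

nAt : ℤ → Bool → Bool → ℤ → ℤ → ℤ
nAt P true  true  b d = b + + 2 * d
nAt P true  false b d = b + + 2 * d + 1ℤ
nAt P false true  b d = P - b - + 2 * d
nAt P false false b d = P - 1ℤ - b - + 2 * d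

mμ≡mAt : ∀ p {f} .{{_ : NonZero f}} (b c : Fin f → ℤ) (J : Subset f) (d : Fin f → ℤ) i →
         mμ p b c J d i ≡ mAt (+ p) (lookup J i) (lookup J (next i)) (b i) (c i) (d i)
mμ≡mAt p b c J d i with lookup J i | lookup J (next i)
... | true  | true  = refl
... | true  | false = refl
... | false | true  = refl
... | false | false = refl

nμ≡nAt : ∀ p {f} .{{_ : NonZero f}} (b : Fin f → ℤ) (J : Subset f) (d : Fin f → ℤ) i →
         nμ p b J d i ≡ nAt (+ p) (lookup J i) (lookup J (next i)) (b i) (d i)
nμ≡nAt p b J d i with lookup J i | lookup J (next i)
... | true  | true  = refl
... | true  | false = refl
... | false | true  = refl
... | false | false = refl

twice-mAt+nAt : ∀ P x y b c d →
  + 2 * mAt P x y b c d + nAt P x y b d ≡ + 2 * c + b - 1ℤ + P + (P * ⟦ x ⟧ - ⟦ y ⟧)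
twice-mAt+nAt P true true b c d =
  (+ 2 * (c + P - 1ℤ - d) + (b + + 2 * d) ≡ + 2 * c + b - 1ℤ + P + (P * 1ℤ - 1ℤ))
  ∋ solve (P ∷ b ∷ c ∷ d ∷ [])
twice-mAt+nAt P true false b c d =
  (+ 2 * (c + P - 1ℤ - d) + (b + + 2 * d + 1ℤ) ≡ + 2 * c + b - 1ℤ + P + (P * 1ℤ - 0ℤ))
  ∋ solve (P ∷ b ∷ c ∷ d ∷ [])
twice-mAt+nAt P false true b c d =
  (+ 2 * (c + b + d - 1ℤ) + (P - b - + 2 * d) ≡ + 2 * c + b - 1ℤ + P + (P * 0ℤ - 1ℤ))
  ∋ solve (P ∷ b ∷ c ∷ d ∷ [])
twice-mAt+nAt P false false b c d =
  (+ 2 * (c + b + d) + (P - 1ℤ - b - + 2 * d) ≡ + 2 * c + b - 1ℤ + P + (P * 0ℤ - 0ℤ))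
  ∋ solve (P ∷ b ∷ c ∷ d ∷ [])

twice-mAt-difference : ∀ P x y x' y' b c d d' → nAt P x y b d ≡ nAt P x' y' b d' →
  + 2 * (mAt P x y b c d - mAt P x' y' b c d') ≡ P * (⟦ x ⟧ - ⟦ x' ⟧) - (⟦ y ⟧ - ⟦ y' ⟧)
twice-mAt-difference P x y x' y' b c d d' n≡n' = begin
  + 2 * (m - m')                       ≡⟨ twice-difference m m' n ⟩
  (+ 2 * m + n) - (+ 2 * m' + n)       ≡⟨ cong₂ _-_ (twice-mAt+nAt P x y b c d)
                                              (subst (λ n″ → + 2 * m' + n″ ≡ _) (sym n≡n')
                                                     (twice-mAt+nAt P x' y' b c d')) ⟩
  (K + (P * X - Y)) - (K + (P * X' - Y')) ≡⟨ regroup K P X Y X' Y' ⟩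
  P * (X - X') - (Y - Y')              ∎
  where
  m = mAt P x y b c d
  m' = mAt P x' y' b c d'
  n = nAt P x y b d
  K = + 2 * c + b - 1ℤ + P
  X = ⟦ x ⟧
  Y = ⟦ y ⟧
  X' = ⟦ x' ⟧
  Y' = ⟦ y' ⟧
  twice-difference : ∀ m m' n → + 2 * (m - m') ≡ (+ 2 * m + n) - (+ 2 * m' + n)
  twice-difference = solve-∀
  regroup : ∀ K P X Y X' Y' → (K + (P * X - Y)) - (K + (P * X' - Y')) ≡ P * (X - X') - (Y - Y')
  regroup = solve-∀

nAt-injective : ∀ P x y b {d d'} → nAt P x y b d ≡ nAt P x y b d' → d ≡ d'
nAt-injective P true  true  b e = *-cancelˡ-≡ (+ 2) _ _ (+-cancelˡ b _ _ e)
nAt-injective P true  false b e = *-cancelˡ-≡ (+ 2) _ _ (+-cancelˡ b _ _ (+-cancelʳ 1ℤ _ _ e))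
nAt-injective P false true  b e = *-cancelˡ-≡ (+ 2) _ _ (neg-injective (+-cancelˡ (P - b) _ _ e))
nAt-injective P false false b e =
  *-cancelˡ-≡ (+ 2) _ _ (neg-injective (+-cancelˡ (P - 1ℤ - b) _ _ e))

twice-mμ-difference : ∀ p {f} .{{_ : NonZero f}} (b c : Fin f → ℤ) (J J' : Subset f)
  (d d' : Fin f → ℤ) i →
  nμ p b J d i ≡ nμ p b J' d' i →
  + 2 * (mμ p b c J d i - mμ p b c J' d' i) ≡
    + p * (⟦ lookup J i ⟧ - ⟦ lookup J' i ⟧) - (⟦ lookup J (next i) ⟧ - ⟦ lookup J' (next i) ⟧)
twice-mμ-difference p b c J J' d d' i n≡n' = begin
  + 2 * (mμ p b c J d i - mμ p b c J' d' i)
    ≡⟨ cong₂ (λ m m' → + 2 * (m - m')) (mμ≡mAt p b c J d i) (mμ≡mAt p b c J' d' i) ⟩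
  + 2 * (mAt (+ p) x y (b i) (c i) (d i) - mAt (+ p) x' y' (b i) (c i) (d' i))
    ≡⟨ twice-mAt-difference (+ p) x y x' y' (b i) (c i) (d i) (d' i)
         (trans (sym (nμ≡nAt p b J d i)) (trans n≡n' (nμ≡nAt p b J' d' i))) ⟩
  + p * (⟦ x ⟧ - ⟦ x' ⟧) - (⟦ y ⟧ - ⟦ y' ⟧) ∎
  where
  x = lookup J i
  y = lookup J (next i)
  x' = lookup J' i
  y' = lookup J' (next i)

nμ-injective : ∀ p {f} .{{_ : NonZero f}} (b : Fin f → ℤ) (J : Subset f) (d d' : Fin f → ℤ) i →
  nμ p b J d i ≡ nμ p b J d' i → d i ≡ d' i
nμ-injective p b J d d' i e =
  nAt-injective (+ p) (lookup J i) (lookup J (next i)) (b i)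
    (trans (sym (nμ≡nAt p b J d i)) (trans e (nμ≡nAt p b J d' i)))

agreement-propagates : ∀ P {x x' y y'} t → x ≡ x' →
  + 2 * t ≡ P * (⟦ x ⟧ - ⟦ x' ⟧) - (⟦ y ⟧ - ⟦ y' ⟧) → y ≡ y'
agreement-propagates P {x} {y = y} {y'} t refl e = ⟦⟧-even-difference y y' (- t) (begin
  ⟦ y ⟧ - ⟦ y' ⟧             ≡⟨ undo Z (⟦ y ⟧ - ⟦ y' ⟧) ⟩
  Z - (Z - (⟦ y ⟧ - ⟦ y' ⟧)) ≡⟨ cong (_-_ Z) e ⟨
  Z - + 2 * t                ≡⟨ vanish P ⟦ x ⟧ t ⟩
  + 2 * (- t)                ∎)
  where
  Z = P * (⟦ x ⟧ - ⟦ x ⟧)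
  undo : ∀ z u → u ≡ z - (z - u)
  undo = solve-∀
  vanish : ∀ P X t → P * (X - X) - + 2 * t ≡ + 2 * (- t)
  vanish = solve-∀

mod-toℕ : ∀ {n} .{{_ : NonZero n}} (i : Fin n) → toℕ i mod n ≡ i
mod-toℕ i = toℕ-injective (trans (toℕ-fromℕ< _) (m<n⇒m%n≡m (toℕ<n i)))

next-mod : ∀ {n} .{{_ : NonZero n}} k → next (k mod n) ≡ ℕ.suc k mod n
next-mod {n} k = toℕ-injective (begin
  toℕ (next (k mod n))            ≡⟨ toℕ-fromℕ< _ ⟩
  ℕ.suc (toℕ (k mod n)) % n       ≡⟨ cong (λ r → ℕ.suc r % n) (toℕ-fromℕ< _) ⟩
  ℕ.suc (k % n) % n               ≡⟨ [m+kn]%n≡m%n (ℕ.suc (k % n)) (k / n) n ⟨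
  ℕ.suc (k % n ℕ.+ k / n ℕ.* n) % n ≡⟨ cong (λ r → ℕ.suc r % n) (m≡m%n+[m/n]*n k n) ⟨
  ℕ.suc k % n                     ≡⟨ toℕ-fromℕ< _ ⟨
  toℕ (ℕ.suc k mod n)             ∎)

next-induction : ∀ {n} (P : Fin (ℕ.suc n) → Set) →
  P zero → (∀ i → P i → P (next i)) → ∀ i → P i
next-induction {n} P P₀ step i = subst P (mod-toℕ i) (along (toℕ i))
  where
  along : ∀ k → P (k mod ℕ.suc n)
  along ℕ.zero    = P₀
  along (ℕ.suc k) = subst P (next-mod k) (step _ (along k))

sumFin-cong : ∀ {n} {g h : Fin n → ℤ} → (∀ i → g i ≡ h i) → sumFin g ≡ sumFin h
sumFin-cong {ℕ.zero}  g≗h = refl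
sumFin-cong {ℕ.suc n} g≗h = cong₂ _+_ (g≗h zero) (sumFin-cong (λ i → g≗h (suc i)))

*-distribˡ-sumFin-difference : ∀ {n} k (g h : Fin n → ℤ) →
  k * (sumFin g - sumFin h) ≡ sumFin (λ i → k * (g i - h i))
*-distribˡ-sumFin-difference {ℕ.zero}  k g h = *-zeroʳ k
*-distribˡ-sumFin-difference {ℕ.suc n} k g h = begin
  k * ((g zero + G) - (h zero + H))   ≡⟨ split k (g zero) G (h zero) H ⟩
  k * (g zero - h zero) + k * (G - H) ≡⟨ cong (_+_ (k * (g zero - h zero)))
                                           (*-distribˡ-sumFin-difference k (g ∘suc) (h ∘suc)) ⟩
  sumFin (λ i → k * (g i - h i))      ∎
  where
  _∘suc : (Fin (ℕ.suc n) → ℤ) → Fin n → ℤ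
  u ∘suc = λ i → u (suc i)
  G = sumFin (g ∘suc)
  H = sumFin (h ∘suc)
  split : ∀ k a s a' s' → k * ((a + s) - (a' + s')) ≡ k * (a - a') + k * (s - s')
  split = solve-∀

∑-telescope : ∀ n (X : ℕ → ℤ) → sumFin {n} (λ i → X (toℕ i) - X (ℕ.suc (toℕ i))) ≡ X 0 - X n
∑-telescope ℕ.zero    X = sym (+-inverseʳ (X 0))
∑-telescope (ℕ.suc n) X = begin
  (X 0 - X 1) + sumFin {n} (λ i → X (ℕ.suc (toℕ i)) - X (ℕ.suc (ℕ.suc (toℕ i))))
    ≡⟨ cong (_+_ (X 0 - X 1)) (∑-telescope n (λ k → X (ℕ.suc k))) ⟩
  (X 0 - X 1) + (X 1 - X (ℕ.suc n)) ≡⟨ +-minus-telescope (X 0) (X 1) (X (ℕ.suc n)) ⟩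
  X 0 - X (ℕ.suc n)                 ∎

∑-cyclic-telescope : ∀ n (P : ℤ) (v : Fin (ℕ.suc n) → ℤ) →
  sumFin (λ i → (P * v i - v (next i)) * P ^ (ℕ.suc n ∸ toℕ i)) ≡ P * v zero * (P ^ ℕ.suc n - 1ℤ)
∑-cyclic-telescope n P v = begin
  sumFin {f} (λ i → (P * v i - v (next i)) * P ^ (f ∸ toℕ i)) ≡⟨ sumFin-cong term≡ ⟩
  sumFin {f} (λ i → X (toℕ i) - X (ℕ.suc (toℕ i)))        ≡⟨ ∑-telescope f X ⟩
  X 0 - X f                                          ≡⟨ cong (_-_ (X 0)) X-last ⟩
  P * v zero * P ^ f - P * v zero * 1ℤ               ≡⟨ factor (P * v zero) (P ^ f) ⟩
  P * v zero * (P ^ f - 1ℤ)                          ∎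
  where
  f = ℕ.suc n
  -- v extended f-periodically to ℕ, so that v (next i) is V (suc (toℕ i)) by definition.
  V : ℕ → ℤ
  V k = v (k mod f)
  X : ℕ → ℤ
  X k = P * V k * P ^ (f ∸ k)
  shift : ∀ P a b Q → (P * a - b) * (P * Q) ≡ P * a * (P * Q) - P * b * Q
  shift = solve-∀
  factor : ∀ a Q → a * Q - a * 1ℤ ≡ a * (Q - 1ℤ)
  factor = solve-∀
  step : ∀ k → k ℕ.≤ n → (P * V k - V (ℕ.suc k)) * P ^ (f ∸ k) ≡ X k - X (ℕ.suc k)
  step k k≤n rewrite ℕ.+-∸-assoc 1 k≤n = shift P (V k) (V (ℕ.suc k)) (P ^ (n ∸ k))
  term≡ : ∀ i → (P * v i - v (next i)) * P ^ (f ∸ toℕ i) ≡ X (toℕ i) - X (ℕ.suc (toℕ i))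
  term≡ i = trans (cong (λ a → (P * a - v (next i)) * P ^ (f ∸ toℕ i)) (cong v (sym (mod-toℕ i))))
                  (step (toℕ i) (ℕ.s≤s⁻¹ (toℕ<n i)))
  X-last : X f ≡ P * v zero * 1ℤ
  X-last = cong₂ (λ j e → P * v j * P ^ e)
                 (toℕ-injective (trans (toℕ-fromℕ< _) (n%n≡0 f))) (ℕ.n∸n≡0 f)

pos-^ : ∀ p n → (+ p) ^ n ≡ + (p ℕ.^ n)
pos-^ p ℕ.zero    = refl
pos-^ p (ℕ.suc n) = trans (cong (+ p *_) (pos-^ p n)) (sym (pos-* p (p ℕ.^ n)))

p^[1+n]-1≢0 : ∀ {p} n → p ≢ 1 → (+ p) ^ ℕ.suc n - 1ℤ ≢ 0ℤ
p^[1+n]-1≢0 {p} n p≢1 eq =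
  p≢1 (ℕ.m*n≡1⇒m≡1 p (p ℕ.^ n)
        (+-injective (trans (sym (pos-^ p (ℕ.suc n))) (i-j≡0⇒i≡j _ _ eq))))

2∣-cofactor : ∀ {M Δ} k → M ≢ 0ℤ → M ∣ Δ → + 2 * Δ ≡ k * M → + 2 ∣ k
2∣-cofactor {M} {Δ} k M≢0 M∣Δ eq =
  *-cancelʳ-∣ M {+ 2} {k} {{≢-nonZero M≢0}} (subst (+ 2 * M ∣_) eq (*-monoʳ-∣ (+ 2) {M} {Δ} M∣Δ))

2∤odd*unit : ∀ p w → p % 2 ≡ 1 → ∣ w ∣ ≡ 1 → ¬ (+ 2 ∣ + p * w)
2∤odd*unit p w odd ∣w∣≡1 2∣pw = 0≢1 (trans (sym (n∣m⇒m%n≡0 p 2 2∣p)) odd)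
  where
  0≢1 : 0 ≢ 1
  0≢1 ()
  2∣p : 2 ∣ℕ p
  2∣p = subst (2 ∣ℕ_)
    (trans (abs-* (+ p) w) (trans (cong (p ℕ.*_) ∣w∣≡1) (ℕ.*-identityʳ p))) 2∣pw

twice-weighted-difference : ∀ p {n} (b c : Fin (ℕ.suc n) → ℤ) (J J' : Subset (ℕ.suc n))
  (d d' : Fin (ℕ.suc n) → ℤ) → (∀ i → nμ p b J d i ≡ nμ p b J' d' i) →
  + 2 * (sumFin (λ i → mμ p b c J d i * (+ p) ^ (ℕ.suc n ∸ toℕ i))
         - sumFin (λ i → mμ p b c J' d' i * (+ p) ^ (ℕ.suc n ∸ toℕ i)))
    ≡ + p * (⟦ lookup J zero ⟧ - ⟦ lookup J' zero ⟧) * ((+ p) ^ ℕ.suc n - 1ℤ)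
twice-weighted-difference p {n} b c J J' d d' n≡n' = begin
  + 2 * (sumFin (λ i → m i * Q i) - sumFin (λ i → m' i * Q i))
    ≡⟨ *-distribˡ-sumFin-difference (+ 2) (λ i → m i * Q i) (λ i → m' i * Q i) ⟩
  sumFin (λ i → + 2 * (m i * Q i - m' i * Q i))
    ≡⟨ sumFin-cong (λ i → trans (factorʳ (m i) (m' i) (Q i))
                                (cong (_* Q i) (twice-mμ-difference p b c J J' d d' i (n≡n' i)))) ⟩
  sumFin (λ i → (+ p * w i - w (next i)) * Q i)
    ≡⟨ ∑-cyclic-telescope n (+ p) w ⟩
  + p * w zero * ((+ p) ^ ℕ.suc n - 1ℤ) ∎
  where
  m m' w Q : Fin (ℕ.suc n) → ℤ
  m = mμ p b c J d
  m' = mμ p b c J' d'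
  w i = ⟦ lookup J i ⟧ - ⟦ lookup J' i ⟧
  Q i = (+ p) ^ (ℕ.suc n ∸ toℕ i)
  factorʳ : ∀ a a' q → + 2 * (a * q - a' * q) ≡ + 2 * (a - a') * q
  factorʳ = solve-∀

lemma3p5 : (p e' f : ℕ) → .{{_ : NonZero f}} → Prime p → p % 2 ≡ 1 → e' ≥ 1 →
           (b c : Fin f → ℤ) →
           (∀ i → 0ℤ ≤ b i × b i ≤ (+ p) - 1ℤ - (+ 2) * (+ e')) →
           (J J' : Subset f) (d d' : Fin f → ℤ) →
           Admissible e' J d → Admissible e' J' d' →
           μIso p b c J d J' d' →
           J ≡ J' × (∀ i → d i ≡ d' i)
lemma3p5 p e' ℕ.zero {{()}}
lemma3p5 p e' (ℕ.suc n) p-prime odd _ b c _ J J' d d' _ _ (n≡n' , M∣Δ) = J≡J' , d≡d'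
  where
  p≢1 : p ≢ 1
  p≢1 = ℕ.nonTrivial⇒≢1 {{prime⇒nonTrivial p-prime}}
  w₀ : ℤ
  w₀ = ⟦ lookup J zero ⟧ - ⟦ lookup J' zero ⟧
  J₀≡J'₀ : lookup J zero ≡ lookup J' zero
  J₀≡J'₀ = decidable-stable (lookup J zero Bool.≟ lookup J' zero) λ J₀≢J'₀ →
    2∤odd*unit p w₀ odd (∣⟦⟧-⟦⟧∣≡1 J₀≢J'₀)
      (2∣-cofactor (+ p * w₀) (p^[1+n]-1≢0 n p≢1) M∣Δ
        (twice-weighted-difference p b c J J' d d' n≡n'))
  J≗J' : ∀ i → lookup J i ≡ lookup J' i
  J≗J' = next-induction (λ i → lookup J i ≡ lookup J' i) J₀≡J'₀ λ i eq →
    agreement-propagates (+ p) _ eq (twice-mμ-difference p b c J J' d d' i (n≡n' i))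
  J≡J' : J ≡ J'
  J≡J' = trans (sym (tabulate∘lookup J)) (trans (tabulate-cong J≗J') (tabulate∘lookup J'))
  d≡d' : ∀ i → d i ≡ d' i
  d≡d' i =
    nμ-injective p b J d d' i (subst (λ K → nμ p b J d i ≡ nμ p b K d' i) (sym J≡J') (n≡n' i))
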